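{- Let $t\ge3$ and $k\ge1$ be integers, let $P$ be a projective plane of order $t-1$, and let $V$ be a set of $(t^2-t+1)k$ vertices partitioned into $t^2-t+1$ buckets of size $k$, one bucket for each point of $P$. Say that a line of $P$ contains a vertex $v\in V$ if $v$ lies in the bucket of a point on that line. Let $X\subseteq V$ with $|X|\ge 9kt$. Then at most $t^2/2$ lines of $P$ contain fewer than $|X|/(2t)$ vertices of $X$.
   Context: A projective plane of order $t-1$ has $t^2-t+1$ points and $t^2-t+1$ lines, each line contains $t$ points, each point lies on $t$ lines, and any two distinct points lie on exactly one common line. (In the paper, $V$ is the vertex set of a tournament built on these buckets; the orientation plays no role in this statement.) -}

module Defs where

open import Data.Nat using (ℕ; zero; suc; _+_; _*_; _∸_; _<_; _≤_)
open import Data.Bool using (Bool; true; false; _∧_; if_then_else_)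
open import Data.Fin using (Fin; zero; suc)
open import Data.Product using (Σ; _×_; _,_)
open import Relation.Nullary using (¬_)
open import Relation.Binary.PropositionalEquality using (_≡_)

sumFin : ∀ {n} → (Fin n → ℕ) → ℕ
sumFin {zero}  f = 0
sumFin {suc n} f = f zero + sumFin (λ i → f (suc i))

count : ∀ {n} → (Fin n → Bool) → ℕ
count P = sumFin (λ i → if P i then 1 else 0)

numPts : ℕ → ℕ
numPts t = t * t ∸ t + 1

-- A projective plane of order t - 1: points and lines are both indexed by
-- Fin (t² - t + 1); incident p L = true  iff  point p lies on line L.
record ProjectivePlane (t : ℕ) : Set where
  field
    incident   : Fin (numPts t) → Fin (numPts t) → Bool
    lineSize   : ∀ L → count (λ p → incident p L) ≡ t
    pointDeg   : ∀ p → count (λ L → incident p L) ≡ t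
    uniqueLine : ∀ p q → ¬ (p ≡ q) →
                 Σ (Fin (numPts t)) λ L →
                   (incident p L ≡ true × incident q L ≡ true) ×
                   (∀ L′ → incident p L′ ≡ true → incident q L′ ≡ true → L′ ≡ L)

-- Vertex set V = (points) × Fin k : vertex (p , i) is the i-th vertex in
-- the bucket of point p.  A subset X ⊆ V is a Boolean predicate.
VSubset : ℕ → ℕ → Set
VSubset t k = Fin (numPts t) → Fin k → Bool

sizeX : ∀ {t k} → VSubset t k → ℕ
sizeX {t} {k} X = sumFin (λ p → count (X p))

onLine : ∀ {t k} → ProjectivePlane t → VSubset t k → Fin (numPts t) → ℕ
onLine P X L =
  sumFin (λ p → if ProjectivePlane.incident P p L then count (X p) else 0)

_<ᵇ_ : ℕ → ℕ → Bool
zero  <ᵇ zero  = false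
zero  <ᵇ suc n = true
suc m <ᵇ zero  = false
suc m <ᵇ suc n = m <ᵇ n

sparseLines : ∀ {t k} → ProjectivePlane t → VSubset t k → ℕ
sparseLines {t} {k} P X = count (λ L → (2 * t * onLine P X L) <ᵇ sizeX {t} {k} X)

-- A second-moment argument. Double counting point–line incidences gives Σ_L |X ∩ L| = t|X|, and,
-- since two distinct points lie on exactly one line, Σ_L |X ∩ L|² = |X|² + (t − 1) Σ_p x_p², where
-- x_p ≤ k is the number of vertices of X in the bucket of p. With t² − t + 1 ≤ t² lines, the
-- deviations t|X ∩ L| − |X| therefore have squares summing to at most t²(t − 1)k|X|. A line with
-- fewer than |X|/(2t) vertices of X has deviation more than |X|/2, so there are at most
-- 4t²(t − 1)k/|X| ≤ 4t(t − 1)/9 < t²/2 such lines, as |X| ≥ 9kt.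
module Submission where

open import Defs
open import Data.Bool using (Bool; true; false; _∧_; if_then_else_)
open import Data.Bool.Properties using (∧-idem)
open import Data.Fin using (Fin; zero; suc; punchIn)
open import Data.Fin.Properties using (punchInᵢ≢i)
open import Data.Nat using (ℕ; zero; suc; _+_; _*_; _∸_; _≤_; _<_; z≤n; s≤s; ∣_-_∣; NonZero; >-nonZero)
open import Data.Nat.Properties
open import Data.Nat.Tactic.RingSolver using (solve-∀)
open import Algebra.Properties.Semiring.Sum +-*-semiring
  using (sum; sum-cong-≗; ∑-distrib-+; ∑-comm; *-distribˡ-sum; *-distribʳ-sum; sum-remove)
open import Function using (_∘′_)
open import Data.Product using (_×_; _,_; proj₁; proj₂)
open import Data.Sum using ([_,_]′)
open import Relation.Nullary using (contradiction)
open import Relation.Binary.PropositionalEquality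

indicator : Bool → ℕ
indicator b = if b then 1 else 0

if-else-0≡indicator-* : ∀ b y → (if b then y else 0) ≡ indicator b * y
if-else-0≡indicator-* true  y = sym (+-identityʳ y)
if-else-0≡indicator-* false y = refl

indicator-∧ : ∀ a b → indicator a * indicator b ≡ indicator (a ∧ b)
indicator-∧ true  b = +-identityʳ (indicator b)
indicator-∧ false b = refl

∧≡true : ∀ {a b} → a ∧ b ≡ true → a ≡ true × b ≡ true
∧≡true {true} {true} _ = refl , refl

sumFin≡sum : ∀ {n} (f : Fin n → ℕ) → sumFin f ≡ sum f
sumFin≡sum {zero}  f = refl
sumFin≡sum {suc n} f = cong (f zero +_) (sumFin≡sum (λ i → f (suc i)))

sumFin-cong : ∀ {n} {f g : Fin n → ℕ} → (∀ i → f i ≡ g i) → sumFin f ≡ sumFin g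
sumFin-cong {f = f} {g} f≗g =
  trans (sumFin≡sum f) (trans (sum-cong-≗ f≗g) (sym (sumFin≡sum g)))

sumFin-distrib-+ : ∀ {n} (f g : Fin n → ℕ) →
                   sumFin (λ i → f i + g i) ≡ sumFin f + sumFin g
sumFin-distrib-+ f g = begin
  sumFin (λ i → f i + g i) ≡⟨ sumFin≡sum (λ i → f i + g i) ⟩
  sum (λ i → f i + g i)    ≡⟨ ∑-distrib-+ f g ⟩
  sum f + sum g            ≡⟨ cong₂ _+_ (sumFin≡sum f) (sumFin≡sum g) ⟨
  sumFin f + sumFin g      ∎
  where open ≡-Reasoning

*-distribˡ-sumFin : ∀ {n} c (f : Fin n → ℕ) → c * sumFin f ≡ sumFin (λ i → c * f i)
*-distribˡ-sumFin c f = begin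
  c * sumFin f           ≡⟨ cong (c *_) (sumFin≡sum f) ⟩
  c * sum f              ≡⟨ *-distribˡ-sum c f ⟩
  sum (λ i → c * f i)    ≡⟨ sumFin≡sum (λ i → c * f i) ⟨
  sumFin (λ i → c * f i) ∎
  where open ≡-Reasoning

*-distribʳ-sumFin : ∀ {n} c (f : Fin n → ℕ) → sumFin f * c ≡ sumFin (λ i → f i * c)
*-distribʳ-sumFin c f = begin
  sumFin f * c           ≡⟨ cong (_* c) (sumFin≡sum f) ⟩
  sum f * c              ≡⟨ *-distribʳ-sum c f ⟩
  sum (λ i → f i * c)    ≡⟨ sumFin≡sum (λ i → f i * c) ⟨
  sumFin (λ i → f i * c) ∎
  where open ≡-Reasoning

sumFin-comm : ∀ {m n} (h : Fin m → Fin n → ℕ) →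
              sumFin (λ i → sumFin (h i)) ≡ sumFin (λ j → sumFin (λ i → h i j))
sumFin-comm h = begin
  sumFin (λ i → sumFin (h i))          ≡⟨ double (λ i j → h i j) ⟩
  sum (λ i → sum (h i))                ≡⟨ ∑-comm h ⟩
  sum (λ j → sum (λ i → h i j))        ≡⟨ double (λ j i → h i j) ⟨
  sumFin (λ j → sumFin (λ i → h i j))  ∎
  where
  open ≡-Reasoning
  double : ∀ {m n} (g : Fin m → Fin n → ℕ) →
           sumFin (λ i → sumFin (g i)) ≡ sum (λ i → sum (g i))
  double g = trans (sumFin-cong (λ i → sumFin≡sum (g i))) (sumFin≡sum (λ i → sum (g i)))

sumFin-*-sumFin : ∀ {m n} (f : Fin m → ℕ) (g : Fin n → ℕ) →
                  sumFin f * sumFin g ≡ sumFin (λ i → sumFin (λ j → f i * g j))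
sumFin-*-sumFin f g = begin
  sumFin f * sumFin g                     ≡⟨ *-distribʳ-sumFin (sumFin g) f ⟩
  sumFin (λ i → f i * sumFin g)           ≡⟨ sumFin-cong (λ i → *-distribˡ-sumFin (f i) g) ⟩
  sumFin (λ i → sumFin (λ j → f i * g j)) ∎
  where open ≡-Reasoning

sumFin-const : ∀ {n} c → sumFin {n} (λ _ → c) ≡ n * c
sumFin-const {zero}  c = refl
sumFin-const {suc n} c = cong (c +_) (sumFin-const {n} c)

sumFin-mono-≤ : ∀ {n} {f g : Fin n → ℕ} → (∀ i → f i ≤ g i) → sumFin f ≤ sumFin g
sumFin-mono-≤ {zero}  f≤g = z≤n
sumFin-mono-≤ {suc n} f≤g = +-mono-≤ (f≤g zero) (sumFin-mono-≤ (λ i → f≤g (suc i)))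

sumFin-update : ∀ {n} (i : Fin n) {f g : Fin n → ℕ} → (∀ j → j ≢ i → f j ≡ g j) →
                sumFin f + g i ≡ sumFin g + f i
sumFin-update {suc n} i {f} {g} f≗g = begin
  sumFin f + g i                       ≡⟨ cong (_+ g i) (trans (sumFin≡sum f) (sum-remove {i = i} f)) ⟩
  f i + sum (f ∘′ punchIn i) + g i     ≡⟨ cong (λ r → f i + r + g i) (sum-cong-≗ off-i) ⟩
  f i + sum (g ∘′ punchIn i) + g i     ≡⟨ swap (f i) (g i) _ ⟩
  g i + sum (g ∘′ punchIn i) + f i     ≡⟨ cong (_+ f i) (trans (sumFin≡sum g) (sum-remove {i = i} g)) ⟨
  sumFin g + f i                       ∎
  where
  open ≡-Reasoning
  off-i : ∀ j → f (punchIn i j) ≡ g (punchIn i j)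
  off-i j = f≗g (punchIn i j) (punchInᵢ≢i i j)
  swap : ∀ a b r → a + r + b ≡ b + r + a
  swap = solve-∀

indicator≤1 : ∀ b → indicator b ≤ 1
indicator≤1 true  = ≤-refl
indicator≤1 false = z≤n

count≤n : ∀ {n} (b : Fin n → Bool) → count b ≤ n
count≤n {n} b = begin
  count b              ≤⟨ sumFin-mono-≤ (λ i → indicator≤1 (b i)) ⟩
  sumFin {n} (λ _ → 1) ≡⟨ trans (sumFin-const {n} 1) (*-identityʳ n) ⟩
  n                    ∎
  where open ≤-Reasoning

count-unique : ∀ {n} (b : Fin n → Bool) (i : Fin n) → b i ≡ true →
               (∀ j → b j ≡ true → j ≡ i) → count b ≡ 1
count-unique {n} b i bi unique = begin
  count b                                ≡⟨ +-identityʳ (count b) ⟨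
  count b + 0                            ≡⟨ sumFin-update i false-off-i ⟩
  sumFin {n} (λ _ → 0) + indicator (b i) ≡⟨ cong₂ _+_ (trans (sumFin-const {n} 0) (*-zeroʳ n)) (cong indicator bi) ⟩
  1                                      ∎
  where
  open ≡-Reasoning
  false-off-i : ∀ j → j ≢ i → indicator (b j) ≡ 0
  false-off-i j j≢i with b j in bj
  ... | true  = contradiction (unique j bj) j≢i
  ... | false = refl

count*≤sumFin : ∀ {n} (b : Fin n → Bool) c (g : Fin n → ℕ) →
                (∀ i → b i ≡ true → c ≤ g i) → count b * c ≤ sumFin g
count*≤sumFin b c g c≤g = begin
  count b * c                        ≡⟨ *-distribʳ-sumFin c (λ i → indicator (b i)) ⟩
  sumFin (λ i → indicator (b i) * c) ≤⟨ sumFin-mono-≤ bound ⟩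
  sumFin g                           ∎
  where
  open ≤-Reasoning
  bound : ∀ i → indicator (b i) * c ≤ g i
  bound i with b i in bi
  ... | true  = subst (_≤ g i) (sym (+-identityʳ c)) (c≤g i bi)
  ... | false = z≤n

<ᵇ≡true⇒< : ∀ m n → (m <ᵇ n) ≡ true → m < n
<ᵇ≡true⇒< zero    (suc n) _   = s≤s z≤n
<ᵇ≡true⇒< (suc m) (suc n) m<n = s≤s (<ᵇ≡true⇒< m n m<n)

∣m-n∣²+2mn≡m²+n² : ∀ m n → ∣ m - n ∣ * ∣ m - n ∣ + 2 * (m * n) ≡ m * m + n * n
∣m-n∣²+2mn≡m²+n² m n = [ ordered , flipped ]′ (≤-total m n)
  where
  Identity : ℕ → ℕ → Set
  Identity m n = ∣ m - n ∣ * ∣ m - n ∣ + 2 * (m * n) ≡ m * m + n * n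
  square : ∀ m d → d * d + 2 * (m * (m + d)) ≡ m * m + (m + d) * (m + d)
  square = solve-∀
  ordered : ∀ {m n} → m ≤ n → Identity m n
  ordered {m} {n} m≤n = subst (Identity m) (m+[n∸m]≡n m≤n) (shifted (n ∸ m))
    where
    shifted : ∀ d → Identity m (m + d)
    shifted d rewrite ∣m-m+n∣≡n m d = square m d
  flipped : n ≤ m → Identity m n
  flipped n≤m = begin
    ∣ m - n ∣ * ∣ m - n ∣ + 2 * (m * n) ≡⟨ cong₂ (λ e p → e * e + 2 * p) (∣-∣-comm m n) (*-comm m n) ⟩
    ∣ n - m ∣ * ∣ n - m ∣ + 2 * (n * m) ≡⟨ ordered n≤m ⟩
    n * n + m * m                       ≡⟨ +-comm (n * n) (m * m) ⟩
    m * m + n * n                       ∎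
    where open ≡-Reasoning

2n<m⇒m≤2∣m-n∣ : ∀ m n → 2 * n < m → m ≤ 2 * ∣ m - n ∣
2n<m⇒m≤2∣m-n∣ m n 2n<m = subst (λ m → m ≤ 2 * ∣ m - n ∣) (m+[n∸m]≡n n≤m) (shifted (m ∸ n) 2n<n+d)
  where
  n≤m : n ≤ m
  n≤m = ≤-trans (m≤m+n n (n + 0)) (<⇒≤ 2n<m)
  2n<n+d : n + (n + 0) < n + (m ∸ n)
  2n<n+d = subst (n + (n + 0) <_) (sym (m+[n∸m]≡n n≤m)) 2n<m
  shifted : ∀ d → n + (n + 0) < n + d → n + d ≤ 2 * ∣ n + d - n ∣
  shifted d 2n<n+d = begin
    n + d                  ≤⟨ +-monoˡ-≤ d (≤-trans (m≤m+n n 0) (<⇒≤ (+-cancelˡ-< n (n + 0) d 2n<n+d))) ⟩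
    d + d                  ≡⟨ cong (d +_) (+-identityʳ d) ⟨
    2 * d                  ≡⟨ cong (2 *_) (trans (∣-∣-comm (n + d) n) (∣m-m+n∣≡n n d)) ⟨
    2 * ∣ n + d - n ∣      ∎
    where open ≤-Reasoning

2n<m⇒m²≤4∣m-n∣² : ∀ m n → 2 * n < m → m * m ≤ 4 * (∣ m - n ∣ * ∣ m - n ∣)
2n<m⇒m²≤4∣m-n∣² m n 2n<m = begin
  m * m                             ≤⟨ *-mono-≤ m≤2d m≤2d ⟩
  (2 * ∣ m - n ∣) * (2 * ∣ m - n ∣) ≡⟨ square-double ∣ m - n ∣ ⟩
  4 * (∣ m - n ∣ * ∣ m - n ∣)       ∎
  where
  open ≤-Reasoning
  m≤2d : m ≤ 2 * ∣ m - n ∣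
  m≤2d = 2n<m⇒m≤2∣m-n∣ m n 2n<m
  square-double : ∀ d → (2 * d) * (2 * d) ≡ 4 * (d * d)
  square-double = solve-∀

-- Σ (c − aᵢ)² = n c² − 2c Σ aᵢ + Σ aᵢ², with the cross term moved across so that no subtraction occurs.
sumFin-∣c-a∣² : ∀ {n} c (a : Fin n → ℕ) →
                sumFin (λ i → ∣ c - a i ∣ * ∣ c - a i ∣) + 2 * (c * sumFin a) ≡
                n * (c * c) + sumFin (λ i → a i * a i)
sumFin-∣c-a∣² {n} c a = begin
  sumFin (λ i → d i * d i) + 2 * (c * sumFin a)
    ≡⟨ cong (λ s → sumFin (λ i → d i * d i) + 2 * s) (*-distribˡ-sumFin c a) ⟩
  sumFin (λ i → d i * d i) + 2 * sumFin (λ i → c * a i)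
    ≡⟨ cong (sumFin (λ i → d i * d i) +_) (*-distribˡ-sumFin 2 (λ i → c * a i)) ⟩
  sumFin (λ i → d i * d i) + sumFin (λ i → 2 * (c * a i))
    ≡⟨ sumFin-distrib-+ (λ i → d i * d i) (λ i → 2 * (c * a i)) ⟨
  sumFin (λ i → d i * d i + 2 * (c * a i))
    ≡⟨ sumFin-cong (λ i → ∣m-n∣²+2mn≡m²+n² c (a i)) ⟩
  sumFin (λ i → c * c + a i * a i)
    ≡⟨ sumFin-distrib-+ (λ _ → c * c) (λ i → a i * a i) ⟩
  sumFin {n} (λ _ → c * c) + sumFin (λ i → a i * a i)
    ≡⟨ cong (_+ sumFin (λ i → a i * a i)) (sumFin-const {n} (c * c)) ⟩
  n * (c * c) + sumFin (λ i → a i * a i)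
    ∎
  where
  open ≡-Reasoning
  d : Fin n → ℕ
  d i = ∣ c - a i ∣

numPts≤t² : ∀ {t} → 1 ≤ t → numPts t ≤ t * t
numPts≤t² {t@(suc _)} 1≤t = begin
  t * t ∸ t + 1 ≤⟨ +-monoʳ-≤ (t * t ∸ t) 1≤t ⟩
  t * t ∸ t + t ≡⟨ m∸n+n≡m (m≤m*n t t) ⟩
  t * t         ∎
  where open ≤-Reasoning

9m≤4[n∸1]n⇒2m≤n² : ∀ m n → 9 * m ≤ 4 * ((n ∸ 1) * n) → 2 * m ≤ n * n
9m≤4[n∸1]n⇒2m≤n² m n 9m≤ = *-cancelˡ-≤ 9 (begin
  9 * (2 * m)             ≡⟨ *-comm 9 (2 * m) ⟩
  2 * m * 9               ≡⟨ *-assoc 2 m 9 ⟩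
  2 * (m * 9)             ≡⟨ cong (2 *_) (*-comm m 9) ⟩
  2 * (9 * m)             ≤⟨ *-monoʳ-≤ 2 9m≤ ⟩
  2 * (4 * ((n ∸ 1) * n)) ≡⟨ *-assoc 2 4 ((n ∸ 1) * n) ⟨
  8 * ((n ∸ 1) * n)       ≤⟨ *-monoʳ-≤ 8 (*-monoˡ-≤ n (m∸n≤m n 1)) ⟩
  8 * (n * n)             ≤⟨ *-monoˡ-≤ (n * n) (n≤1+n 8) ⟩
  9 * (n * n)             ∎)
  where open ≤-Reasoning

module _ {t} (P : ProjectivePlane t) where
  open ProjectivePlane P

  coLines : Fin (numPts t) → Fin (numPts t) → ℕ
  coLines p q = count (λ L → incident p L ∧ incident q L)

  coLines-diagonal : ∀ p → coLines p p ≡ t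
  coLines-diagonal p = trans (sumFin-cong (λ L → cong indicator (∧-idem (incident p L)))) (pointDeg p)

  coLines-offDiagonal : ∀ {p q} → p ≢ q → coLines p q ≡ 1
  coLines-offDiagonal {p} {q} p≢q with uniqueLine p q p≢q
  ... | L , (p∈L , q∈L) , unique =
    count-unique (λ L → incident p L ∧ incident q L) L (cong₂ _∧_ p∈L q∈L)
      (λ L′ pq∈L′ → unique L′ (proj₁ (∧≡true pq∈L′)) (proj₂ (∧≡true pq∈L′)))

module _ {t k} (P : ProjectivePlane t) (X : VSubset t k) where
  open ProjectivePlane P

  private
    ∣X∣ : ℕ
    ∣X∣ = sizeX {t} {k} X

  load : Fin (numPts t) → ℕ
  load p = count (X p)

  loadOn : Fin (numPts t) → Fin (numPts t) → ℕ
  loadOn p L = indicator (incident p L) * load p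

  onLine≡sumFin-loadOn : ∀ L → onLine P X L ≡ sumFin (λ p → loadOn p L)
  onLine≡sumFin-loadOn L = sumFin-cong (λ p → if-else-0≡indicator-* (incident p L) (load p))

  sumFin-onLine : sumFin (onLine P X) ≡ t * ∣X∣
  sumFin-onLine = begin
    sumFin (onLine P X)                         ≡⟨ sumFin-cong onLine≡sumFin-loadOn ⟩
    sumFin (λ L → sumFin (λ p → loadOn p L))    ≡⟨ sumFin-comm (λ L p → loadOn p L) ⟩
    sumFin (λ p → sumFin (λ L → loadOn p L))    ≡⟨ sumFin-cong (λ p → *-distribʳ-sumFin (load p) (λ L → indicator (incident p L))) ⟨
    sumFin (λ p → count (incident p) * load p)  ≡⟨ sumFin-cong (λ p → cong (_* load p) (pointDeg p)) ⟩
    sumFin (λ p → t * load p)                   ≡⟨ *-distribˡ-sumFin t load ⟨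
    t * ∣X∣                                     ∎
    where open ≡-Reasoning

  sumFin-loadOn-pair : ∀ p q → sumFin (λ L → loadOn p L * loadOn q L) ≡ load p * (coLines P p q * load q)
  sumFin-loadOn-pair p q = begin
    sumFin (λ L → loadOn p L * loadOn q L)
      ≡⟨ sumFin-cong (λ L → regroup (ind p L) (load p) (ind q L) (load q)) ⟩
    sumFin (λ L → load p * ((ind p L * ind q L) * load q))
      ≡⟨ *-distribˡ-sumFin (load p) (λ L → (ind p L * ind q L) * load q) ⟨
    load p * sumFin (λ L → (ind p L * ind q L) * load q)
      ≡⟨ cong (load p *_) (*-distribʳ-sumFin (load q) (λ L → ind p L * ind q L)) ⟨
    load p * (sumFin (λ L → ind p L * ind q L) * load q)
      ≡⟨ cong (λ c → load p * (c * load q)) (sumFin-cong (λ L → indicator-∧ (incident p L) (incident q L))) ⟩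
    load p * (coLines P p q * load q)
      ∎
    where
    open ≡-Reasoning
    ind : Fin (numPts t) → Fin (numPts t) → ℕ
    ind p L = indicator (incident p L)
    regroup : ∀ a b c d → (a * b) * (c * d) ≡ b * ((a * c) * d)
    regroup = solve-∀

  sumFin-onLine² : sumFin (λ L → onLine P X L * onLine P X L) ≡
                   sumFin (λ p → load p * sumFin (λ q → coLines P p q * load q))
  sumFin-onLine² = begin
    sumFin (λ L → onLine P X L * onLine P X L)
      ≡⟨ sumFin-cong (λ L → trans (cong₂ _*_ (onLine≡sumFin-loadOn L) (onLine≡sumFin-loadOn L))
                                  (sumFin-*-sumFin (λ p → loadOn p L) (λ q → loadOn q L))) ⟩
    sumFin (λ L → sumFin (λ p → sumFin (λ q → loadOn p L * loadOn q L)))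
      ≡⟨ sumFin-comm (λ L p → sumFin (λ q → loadOn p L * loadOn q L)) ⟩
    sumFin (λ p → sumFin (λ L → sumFin (λ q → loadOn p L * loadOn q L)))
      ≡⟨ sumFin-cong (λ p → sumFin-comm (λ L q → loadOn p L * loadOn q L)) ⟩
    sumFin (λ p → sumFin (λ q → sumFin (λ L → loadOn p L * loadOn q L)))
      ≡⟨ sumFin-cong (λ p → sumFin-cong (sumFin-loadOn-pair p)) ⟩
    sumFin (λ p → sumFin (λ q → load p * (coLines P p q * load q)))
      ≡⟨ sumFin-cong (λ p → *-distribˡ-sumFin (load p) (λ q → coLines P p q * load q)) ⟨
    sumFin (λ p → load p * sumFin (λ q → coLines P p q * load q))
      ∎
    where open ≡-Reasoning

  coLines-row : ∀ p → sumFin (λ q → coLines P p q * load q) + load p ≡ ∣X∣ + t * load p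
  coLines-row p = trans (sumFin-update p off-p) (cong (λ c → ∣X∣ + c * load p) (coLines-diagonal P p))
    where
    off-p : ∀ q → q ≢ p → coLines P p q * load q ≡ load q
    off-p q q≢p = trans (cong (_* load q) (coLines-offDiagonal P (q≢p ∘′ sym))) (+-identityʳ (load q))

  sumFin-onLine²+sumFin-load² :
    sumFin (λ L → onLine P X L * onLine P X L) + sumFin (λ p → load p * load p) ≡
    ∣X∣ * ∣X∣ + t * sumFin (λ p → load p * load p)
  sumFin-onLine²+sumFin-load² = begin
    sumFin (λ L → onLine P X L * onLine P X L) + sumFin (λ p → load p * load p)
      ≡⟨ cong (_+ sumFin (λ p → load p * load p)) sumFin-onLine² ⟩
    sumFin (λ p → load p * row p) + sumFin (λ p → load p * load p)
      ≡⟨ sumFin-distrib-+ (λ p → load p * row p) (λ p → load p * load p) ⟨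
    sumFin (λ p → load p * row p + load p * load p)
      ≡⟨ sumFin-cong (λ p → trans (sym (*-distribˡ-+ (load p) (row p) (load p))) (cong (load p *_) (coLines-row p))) ⟩
    sumFin (λ p → load p * (∣X∣ + t * load p))
      ≡⟨ sumFin-cong (λ p → split (load p) ∣X∣ t) ⟩
    sumFin (λ p → load p * ∣X∣ + t * (load p * load p))
      ≡⟨ sumFin-distrib-+ (λ p → load p * ∣X∣) (λ p → t * (load p * load p)) ⟩
    sumFin (λ p → load p * ∣X∣) + sumFin (λ p → t * (load p * load p))
      ≡⟨ cong₂ _+_ (*-distribʳ-sumFin ∣X∣ load) (*-distribˡ-sumFin t (λ p → load p * load p)) ⟨
    ∣X∣ * ∣X∣ + t * sumFin (λ p → load p * load p)
      ∎
    where
    open ≡-Reasoning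
    row : Fin (numPts t) → ℕ
    row p = sumFin (λ q → coLines P p q * load q)
    split : ∀ x N t → x * (N + t * x) ≡ x * N + t * (x * x)
    split = solve-∀

  sumFin-load²≤k∣X∣ : sumFin (λ p → load p * load p) ≤ k * ∣X∣
  sumFin-load²≤k∣X∣ = begin
    sumFin (λ p → load p * load p) ≤⟨ sumFin-mono-≤ (λ p → *-monoˡ-≤ (load p) (count≤n (X p))) ⟩
    sumFin (λ p → k * load p)      ≡⟨ *-distribˡ-sumFin k load ⟨
    k * ∣X∣                        ∎
    where open ≤-Reasoning

  -- t times the distance of onLine P X L from its mean |X|/t
  deviation : Fin (numPts t) → ℕ
  deviation L = ∣ ∣X∣ - t * onLine P X L ∣

  spread : ℕ
  spread = sumFin (λ L → deviation L * deviation L)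

  spread-identity : spread + 2 * (∣X∣ * (t * (t * ∣X∣))) ≡
                    numPts t * (∣X∣ * ∣X∣) + t * t * sumFin (λ L → onLine P X L * onLine P X L)
  spread-identity = begin
    spread + 2 * (∣X∣ * (t * (t * ∣X∣)))
      ≡⟨ cong (λ s → spread + 2 * (∣X∣ * s)) (trans (sym (*-distribˡ-sumFin t f)) (cong (t *_) sumFin-onLine)) ⟨
    spread + 2 * (∣X∣ * sumFin (λ L → t * f L))
      ≡⟨ sumFin-∣c-a∣² ∣X∣ (λ L → t * f L) ⟩
    numPts t * (∣X∣ * ∣X∣) + sumFin (λ L → (t * f L) * (t * f L))
      ≡⟨ cong (numPts t * (∣X∣ * ∣X∣) +_) (sumFin-cong (λ L → square-scale t (f L))) ⟩
    numPts t * (∣X∣ * ∣X∣) + sumFin (λ L → t * t * (f L * f L))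
      ≡⟨ cong (numPts t * (∣X∣ * ∣X∣) +_) (*-distribˡ-sumFin (t * t) (λ L → f L * f L)) ⟨
    numPts t * (∣X∣ * ∣X∣) + t * t * sumFin (λ L → f L * f L)
      ∎
    where
    open ≡-Reasoning
    f : Fin (numPts t) → ℕ
    f = onLine P X
    square-scale : ∀ t a → (t * a) * (t * a) ≡ t * t * (a * a)
    square-scale = solve-∀

  spread-bound : 1 ≤ t → spread ≤ (t ∸ 1) * (t * t * sumFin (λ p → load p * load p))
  spread-bound 1≤t = begin
    spread                 ≤⟨ m+n≤o⇒m≤o∸n spread (+-cancelʳ-≤ _ _ _ spread+t²Q+2t²N²≤) ⟩
    t * t²Q ∸ t²Q          ≡⟨ cong (t * t²Q ∸_) (*-identityˡ t²Q) ⟨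
    t * t²Q ∸ 1 * t²Q      ≡⟨ *-distribʳ-∸ t²Q t 1 ⟨
    (t ∸ 1) * t²Q          ∎
    where
    open ≤-Reasoning
    N Q F₂ t²Q 2t²N² : ℕ
    N = ∣X∣
    Q = sumFin (λ p → load p * load p)
    F₂ = sumFin (λ L → onLine P X L * onLine P X L)
    t²Q = t * t * Q
    2t²N² = 2 * (N * (t * (t * N)))
    swap : ∀ a b c → a + b + c ≡ a + c + b
    swap = solve-∀
    collect : ∀ t N Q → t * t * (N * N) + t * t * (N * N + t * Q) ≡ t * (t * t * Q) + 2 * (N * (t * (t * N)))
    collect = solve-∀
    spread+t²Q+2t²N²≤ : spread + t²Q + 2t²N² ≤ t * t²Q + 2t²N²
    spread+t²Q+2t²N²≤ = begin
      spread + t²Q + 2t²N²                              ≡⟨ swap spread t²Q 2t²N² ⟩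
      spread + 2t²N² + t²Q                              ≡⟨ cong (_+ t²Q) spread-identity ⟩
      numPts t * (N * N) + t * t * F₂ + t²Q             ≡⟨ +-assoc (numPts t * (N * N)) (t * t * F₂) t²Q ⟩
      numPts t * (N * N) + (t * t * F₂ + t²Q)           ≡⟨ cong (numPts t * (N * N) +_) (*-distribˡ-+ (t * t) F₂ Q) ⟨
      numPts t * (N * N) + t * t * (F₂ + Q)             ≡⟨ cong (λ e → numPts t * (N * N) + t * t * e) sumFin-onLine²+sumFin-load² ⟩
      numPts t * (N * N) + t * t * (N * N + t * Q)      ≤⟨ +-monoˡ-≤ (t * t * (N * N + t * Q)) (*-monoˡ-≤ (N * N) (numPts≤t² 1≤t)) ⟩
      t * t * (N * N) + t * t * (N * N + t * Q)         ≡⟨ collect t N Q ⟩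
      t * t²Q + 2t²N²                                   ∎

  sparseLines*∣X∣²≤4*spread : sparseLines P X * (∣X∣ * ∣X∣) ≤ 4 * spread
  sparseLines*∣X∣²≤4*spread = begin
    sparseLines P X * (∣X∣ * ∣X∣)
      ≤⟨ count*≤sumFin (λ L → (2 * t * onLine P X L) <ᵇ ∣X∣) (∣X∣ * ∣X∣) (λ L → 4 * (deviation L * deviation L)) sparse⇒ ⟩
    sumFin (λ L → 4 * (deviation L * deviation L))
      ≡⟨ *-distribˡ-sumFin 4 (λ L → deviation L * deviation L) ⟨
    4 * spread
      ∎
    where
    open ≤-Reasoning
    sparse⇒ : ∀ L → ((2 * t * onLine P X L) <ᵇ ∣X∣) ≡ true → ∣X∣ * ∣X∣ ≤ 4 * (deviation L * deviation L)
    sparse⇒ L sparse = 2n<m⇒m²≤4∣m-n∣² ∣X∣ (t * onLine P X L)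
      (subst (_< ∣X∣) (*-assoc 2 t (onLine P X L)) (<ᵇ≡true⇒< (2 * t * onLine P X L) ∣X∣ sparse))

lemma3p3 : (t k : ℕ) → 3 ≤ t → 1 ≤ k → (P : ProjectivePlane t) → (X : VSubset t k) →
    9 * k * t ≤ sizeX {t} {k} X →
    2 * sparseLines P X ≤ t * t
lemma3p3 t@(suc _) k@(suc _) _ _ P X 9kt≤N =
  9m≤4[n∸1]n⇒2m≤n² s t (*-cancelʳ-≤ (9 * s) (4 * ((t ∸ 1) * t)) (k * t * N) chain)
  where
  open ≤-Reasoning
  N s : ℕ
  N = sizeX {t} {k} X
  s = sparseLines P X
  instance
    N≢0 : NonZero N
    N≢0 = >-nonZero (≤-trans (s≤s z≤n) 9kt≤N)
    ktN≢0 : NonZero (k * t * N)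
    ktN≢0 = m*n≢0 (k * t) N
  regroup₁ : ∀ s k t N → 9 * s * (k * t * N) ≡ s * (9 * k * t * N)
  regroup₁ = solve-∀
  regroup₂ : ∀ u t k N → 4 * (u * (t * t * (k * N))) ≡ 4 * (u * t) * (k * t * N)
  regroup₂ = solve-∀
  chain : 9 * s * (k * t * N) ≤ 4 * ((t ∸ 1) * t) * (k * t * N)
  chain = begin
    9 * s * (k * t * N)                  ≡⟨ regroup₁ s k t N ⟩
    s * (9 * k * t * N)                  ≤⟨ *-monoʳ-≤ s (*-monoˡ-≤ N 9kt≤N) ⟩
    s * (N * N)                          ≤⟨ sparseLines*∣X∣²≤4*spread P X ⟩
    4 * spread P X                       ≤⟨ *-monoʳ-≤ 4 (spread-bound P X (s≤s z≤n)) ⟩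
    4 * ((t ∸ 1) * (t * t * sumFin-load²)) ≤⟨ *-monoʳ-≤ 4 (*-monoʳ-≤ (t ∸ 1) (*-monoʳ-≤ (t * t) (sumFin-load²≤k∣X∣ P X))) ⟩
    4 * ((t ∸ 1) * (t * t * (k * N)))    ≡⟨ regroup₂ (t ∸ 1) t k N ⟩
    4 * ((t ∸ 1) * t) * (k * t * N)      ∎
    where
    sumFin-load² : ℕ
    sumFin-load² = sumFin (λ p → load P X p * load P X p)
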